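{- Let $n \ge 1$, let $G_n$ and $q_n: G_n \to A_n$ be as in the context, and let $g \in G_n$ with $q_n(g) \neq 0$. Then the order of $g$ equals the order of $q_n(g)$.
   Context: Let $A_n = \mathbb{Z}/3\mathbb{Z} \oplus (\mathbb{Z}/9\mathbb{Z})^n$. Let $\pi_0: A_n \to \mathbb{Z}/3\mathbb{Z}$ be the projection onto the first summand, and for $1 \le i \le n$ let $\pi_i: A_n \to \mathbb{Z}/3\mathbb{Z}$ be the projection onto the $i$-th copy of $\mathbb{Z}/9\mathbb{Z}$ followed by reduction modulo $3$. Let $\theta = (\theta_1,\dots,\theta_n)$ with $\theta_i(a,b) := \pi_0(a)\pi_i(b)$. Let $G_n$ be the set $(\mathbb{Z}/3\mathbb{Z})^n \times A_n$ with group law $(c_1,a_1)(c_2,a_2) = (c_1 + c_2 + \theta(a_1,a_2), a_1 + a_2)$, and $q_n(c,a) = a$. -}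

module Defs where

open import Data.Nat using (ℕ; zero; suc; _*_; _<_)
import Data.Nat as ℕ
open import Data.Nat.DivMod using (_mod_)
open import Data.Fin using (Fin; toℕ)
import Data.Fin as F
open import Data.Vec using (Vec; []; _∷_; zipWith; replicate)
open import Data.Product using (_×_; _,_; proj₁; proj₂)
open import Relation.Binary.PropositionalEquality using (_≡_)
open import Relation.Nullary using (¬_)

ℤmod : ℕ → Set
ℤmod m = Fin m

_+₃_ : ℤmod 3 → ℤmod 3 → ℤmod 3
a +₃ b = (toℕ a ℕ.+ toℕ b) mod 3

_*₃_ : ℤmod 3 → ℤmod 3 → ℤmod 3
a *₃ b = (toℕ a * toℕ b) mod 3

_+₉_ : ℤmod 9 → ℤmod 9 → ℤmod 9
a +₉ b = (toℕ a ℕ.+ toℕ b) mod 9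

red : ℤmod 9 → ℤmod 3
red b = toℕ b mod 3

A : ℕ → Set
A n = ℤmod 3 × Vec (ℤmod 9) n

A-add : ∀ {n} → A n → A n → A n
A-add (a , b) (a' , b') = (a +₃ a') , zipWith _+₉_ b b'

A-zero : ∀ n → A n
A-zero n = F.zero , replicate n F.zero

-- π₀ and π_i (i = 1..n, encoded as the Vec positions)
π₀ : ∀ {n} → A n → ℤmod 3
π₀ = proj₁

θ : ∀ {n} → A n → A n → Vec (ℤmod 3) n
θ x (_ , b) = Data.Vec.map (λ bi → π₀ x *₃ red bi) b

G : ℕ → Set
G n = Vec (ℤmod 3) n × A n

G-mul : ∀ {n} → G n → G n → G n
G-mul (c₁ , a₁) (c₂ , a₂) =
  zipWith _+₃_ (zipWith _+₃_ c₁ c₂) (θ a₁ a₂) , A-add a₁ a₂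

G-one : ∀ n → G n
G-one n = replicate n F.zero , A-zero n

q : ∀ {n} → G n → A n
q = proj₂

pow : {X : Set} → (X → X → X) → X → X → ℕ → X
pow _·_ e x zero = e
pow _·_ e x (suc k) = x · pow _·_ e x k

IsOrder : {X : Set} → (X → X → X) → X → X → ℕ → Set
IsOrder _·_ e x k =
  (0 < k) × (pow _·_ e x k ≡ e) × (∀ m → 0 < m → m < k → ¬ (pow _·_ e x m ≡ e))

-- In G₁ one has g³ = (0, q(g)³): the twist contributes a₀·red(b)·(1 + 2) ≡ 0 (mod 3).
-- Hence g³ = 1 exactly when q(g)³ = 0, and g⁹ = 1 always. Multiplication in G_{1+n}
-- is coordinatewise in G₁ × G_n, so these finitely checkable facts about the 81
-- elements of G₁ hold in every G_n. Since q is a homomorphism, the order of q(g)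
-- (3 or 9, according to whether q(g)³ vanishes) then annihilates g, and no smaller
-- positive power can, so it is also the order of g.
module Submission where

open import Defs
open import Data.Fin using (Fin; toℕ; fromℕ<)
import Data.Fin as F
open import Data.Fin.Properties using (all?; toℕ-fromℕ<) renaming (_≟_ to _≟F_)
open import Data.Nat using (ℕ; zero; suc; _≥_; _<_; s≤s; z≤n)
open import Data.Product using (∃; _×_; _,_)
import Data.Product.Properties as Product
open import Data.Vec using (Vec; []; _∷_; zipWith; replicate)
import Data.Vec.Properties as Vec
open import Function using (_∘_)
open import Relation.Binary.Definitions using (DecidableEquality)
open import Relation.Binary.PropositionalEquality
  using (_≡_; refl; sym; trans; cong; cong₂; subst; module ≡-Reasoning)
open import Relation.Nullary using (¬_; Dec; yes; no)
open import Relation.Nullary.Decidable using (from-yes; map′; _→-dec_)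

pow-hom : {X Y : Set} {_·_ : X → X → X} {_∙_ : Y → Y → Y} {e : X} {e′ : Y}
  (h : X → Y) → h e ≡ e′ → (∀ x y → h (x · y) ≡ h x ∙ h y) →
  ∀ x m → h (pow _·_ e x m) ≡ pow _∙_ e′ (h x) m
pow-hom h h-e h-· x zero = h-e
pow-hom {_·_ = _·_} {_∙_} {e} {e′} h h-e h-· x (suc m) = begin
  h (x · pow _·_ e x m)          ≡⟨ h-· x _ ⟩
  h x ∙ h (pow _·_ e x m)        ≡⟨ cong (h x ∙_) (pow-hom h h-e h-· x m) ⟩
  h x ∙ pow _∙_ e′ (h x) m       ∎
  where open ≡-Reasoning

IsOrder-lift : {X Y : Set} {_·_ : X → X → X} {_∙_ : Y → Y → Y} {e : X} {e′ : Y} {x : X}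
  (h : X → Y) → (∀ m → h (pow _·_ e x m) ≡ pow _∙_ e′ (h x) m) →
  ∀ {k} → IsOrder _∙_ e′ (h x) k → pow _·_ e x k ≡ e → IsOrder _·_ e x k
IsOrder-lift h h-pow (0<k , _ , minimal) xᵏ≡e =
  0<k , xᵏ≡e , λ m 0<m m<k xᵐ≡e →
    minimal m 0<m m<k (trans (sym (h-pow m)) (trans (cong h xᵐ≡e) (h-pow 0)))

_^_ : ∀ {n} → G n → ℕ → G n
g ^ m = pow G-mul (G-one _) g m

≡-decA : ∀ {n} → DecidableEquality (A n)
≡-decA = Product.≡-dec _≟F_ (Vec.≡-dec _≟F_)

≡-decG : ∀ {n} → DecidableEquality (G n)
≡-decG = Product.≡-dec (Vec.≡-dec _≟F_) ≡-decA

q-pow : ∀ {n} (g : G n) m → q (g ^ m) ≡ pow A-add (A-zero n) (q g) m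
q-pow = pow-hom q refl (λ _ _ → refl)

+₃-identityʳ : ∀ a → a +₃ F.zero ≡ a
+₃-identityʳ = from-yes (all? λ a → a +₃ F.zero ≟F a)

+₉-identityʳ : ∀ a → a +₉ F.zero ≡ a
+₉-identityʳ = from-yes (all? λ a → a +₉ F.zero ≟F a)

A-identityʳ : ∀ {n} (a : A n) → A-add a (A-zero n) ≡ a
A-identityʳ (a₀ , b) = cong₂ _,_ (+₃-identityʳ a₀) (zipWith-identityʳ b)
  where
  zipWith-identityʳ : ∀ {n} (b : Vec (ℤmod 9) n) → zipWith _+₉_ b (replicate n F.zero) ≡ b
  zipWith-identityʳ [] = refl
  zipWith-identityʳ (x ∷ b) = cong₂ _∷_ (+₉-identityʳ x) (zipWith-identityʳ b)

π-head : ∀ {n} → G (suc n) → G 1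
π-head (c ∷ _ , a₀ , b ∷ _) = c ∷ [] , a₀ , b ∷ []

π-tail : ∀ {n} → G (suc n) → G n
π-tail (_ ∷ c , a₀ , _ ∷ b) = c , a₀ , b

π-head-pow : ∀ {n} (g : G (suc n)) m → π-head (g ^ m) ≡ π-head g ^ m
π-head-pow = pow-hom π-head refl λ where
  (_ ∷ _ , _ , _ ∷ _) (_ ∷ _ , _ , _ ∷ _) → refl

π-tail-pow : ∀ {n} (g : G (suc n)) m → π-tail (g ^ m) ≡ π-tail g ^ m
π-tail-pow = pow-hom π-tail refl λ where
  (_ ∷ _ , _ , _ ∷ _) (_ ∷ _ , _ , _ ∷ _) → refl

≡-one-join : ∀ {n} (x : G (suc n)) → π-head x ≡ G-one 1 → π-tail x ≡ G-one n → x ≡ G-one (suc n)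
≡-one-join (_ ∷ _ , _ , _ ∷ _) refl refl = refl

q≡zero-join : ∀ {n} (x : G (suc n)) →
  q (π-head x) ≡ A-zero 1 → q (π-tail x) ≡ A-zero n → q x ≡ A-zero (suc n)
q≡zero-join (_ ∷ _ , _ , _ ∷ _) refl refl = refl

q≡zero-head : ∀ {n} (x : G (suc n)) → q x ≡ A-zero (suc n) → q (π-head x) ≡ A-zero 1
q≡zero-head (_ ∷ _ , _ , _ ∷ _) refl = refl

q≡zero-tail : ∀ {n} (x : G (suc n)) → q x ≡ A-zero (suc n) → q (π-tail x) ≡ A-zero n
q≡zero-tail (_ ∷ _ , _ , _ ∷ _) refl = refl

module _ {n} (g : G (suc n)) (m : ℕ) (qgᵐ≡0 : q (g ^ m) ≡ A-zero (suc n)) where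

  q-pow≡zero-head : q (π-head g ^ m) ≡ A-zero 1
  q-pow≡zero-head = subst (λ x → q x ≡ A-zero 1) (π-head-pow g m) (q≡zero-head (g ^ m) qgᵐ≡0)

  q-pow≡zero-tail : q (π-tail g ^ m) ≡ A-zero n
  q-pow≡zero-tail = subst (λ x → q x ≡ A-zero n) (π-tail-pow g m) (q≡zero-tail (g ^ m) qgᵐ≡0)

lift-q≡zero⇒≡one : ∀ i j →
  (∀ (g : G 1) → q (g ^ i) ≡ A-zero 1 → g ^ j ≡ G-one 1) →
  ∀ n (g : G (suc n)) → q (g ^ i) ≡ A-zero (suc n) → g ^ j ≡ G-one (suc n)
lift-q≡zero⇒≡one _ _ base zero g = base g
lift-q≡zero⇒≡one i j base (suc n) g qgⁱ≡0 = ≡-one-join (g ^ j)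
  (trans (π-head-pow g j) (base (π-head g) (q-pow≡zero-head g i qgⁱ≡0)))
  (trans (π-tail-pow g j) (lift-q≡zero⇒≡one i j base n (π-tail g) (q-pow≡zero-tail g i qgⁱ≡0)))

lift-q≡zero⇒q≡zero : ∀ i j →
  (∀ (g : G 1) → q (g ^ i) ≡ A-zero 1 → q (g ^ j) ≡ A-zero 1) →
  ∀ n (g : G (suc n)) → q (g ^ i) ≡ A-zero (suc n) → q (g ^ j) ≡ A-zero (suc n)
lift-q≡zero⇒q≡zero _ _ base zero g = base g
lift-q≡zero⇒q≡zero i j base (suc n) g qgⁱ≡0 = q≡zero-join (g ^ j)
  (subst (λ x → q x ≡ A-zero 1) (sym (π-head-pow g j))
    (base (π-head g) (q-pow≡zero-head g i qgⁱ≡0)))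
  (subst (λ x → q x ≡ A-zero (suc n)) (sym (π-tail-pow g j))
    (lift-q≡zero⇒q≡zero i j base n (π-tail g) (q-pow≡zero-tail g i qgⁱ≡0)))

all-G₁? : {P : G 1 → Set} → (∀ g → Dec (P g)) → Dec (∀ g → P g)
all-G₁? P? = map′
  (λ ∀P → λ { (c ∷ [] , a₀ , b ∷ []) → ∀P c a₀ b })
  (λ ∀P c a₀ b → ∀P (c ∷ [] , a₀ , b ∷ []))
  (all? λ c → all? λ a₀ → all? λ b → P? (c ∷ [] , a₀ , b ∷ []))

cube≡one₁ : ∀ (g : G 1) → q (g ^ 3) ≡ A-zero 1 → g ^ 3 ≡ G-one 1
cube≡one₁ = from-yes (all-G₁? λ g → ≡-decA (q (g ^ 3)) (A-zero 1) →-dec ≡-decG (g ^ 3) (G-one 1))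

pow9≡one₁ : ∀ (g : G 1) → g ^ 9 ≡ G-one 1
pow9≡one₁ = from-yes (all-G₁? λ g → ≡-decG (g ^ 9) (G-one 1))

q-square≡zero₁ : ∀ (g : G 1) → q (g ^ 2) ≡ A-zero 1 → q (g ^ 1) ≡ A-zero 1
q-square≡zero₁ = from-yes (all-G₁? λ g → ≡-decA (q (g ^ 2)) (A-zero 1) →-dec ≡-decA (q (g ^ 1)) (A-zero 1))

q-pow≡zero⇒q-cube≡zero₁ : ∀ (i : Fin 8) (g : G 1) →
  q (g ^ suc (toℕ i)) ≡ A-zero 1 → q (g ^ 3) ≡ A-zero 1
q-pow≡zero⇒q-cube≡zero₁ = from-yes (all? {n = 8} λ i → all-G₁? λ g →
  ≡-decA (q (g ^ suc (toℕ i))) (A-zero 1) →-dec ≡-decA (q (g ^ 3)) (A-zero 1))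

module _ (n : ℕ) (g : G (suc n)) where

  cube≡one : q (g ^ 3) ≡ A-zero (suc n) → g ^ 3 ≡ G-one (suc n)
  cube≡one = lift-q≡zero⇒≡one 3 3 cube≡one₁ n g

  pow9≡one : g ^ 9 ≡ G-one (suc n)
  pow9≡one = lift-q≡zero⇒≡one 0 9 (λ g _ → pow9≡one₁ g) n g refl

  q-square≡zero⇒q≡zero : q (g ^ 2) ≡ A-zero (suc n) → q g ≡ A-zero (suc n)
  q-square≡zero⇒q≡zero qg²≡0 =
    trans (sym (A-identityʳ (q g))) (lift-q≡zero⇒q≡zero 2 1 q-square≡zero₁ n g qg²≡0)

  q-pow≡zero⇒q-cube≡zero : ∀ m → 0 < m → m < 9 →
    q (g ^ m) ≡ A-zero (suc n) → q (g ^ 3) ≡ A-zero (suc n)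
  q-pow≡zero⇒q-cube≡zero (suc m) _ (s≤s m<8) qgᵐ≡0 =
    lift-q≡zero⇒q≡zero (suc (toℕ (fromℕ< m<8))) 3 (q-pow≡zero⇒q-cube≡zero₁ (fromℕ< m<8)) n g
      (subst (λ k → q (g ^ suc k) ≡ A-zero (suc n)) (sym (toℕ-fromℕ< m<8)) qgᵐ≡0)

q-IsOrder : ∀ {n} (g : G n) {k} → 0 < k → q (g ^ k) ≡ A-zero n →
  (∀ m → 0 < m → m < k → ¬ q (g ^ m) ≡ A-zero n) → IsOrder A-add (A-zero n) (q g) k
q-IsOrder g {k} 0<k qgᵏ≡0 minimal =
  0<k , trans (sym (q-pow g k)) qgᵏ≡0 , λ m 0<m m<k → minimal m 0<m m<k ∘ trans (q-pow g m)

q-order-annihilates : ∀ n (g : G (suc n)) → ¬ q g ≡ A-zero (suc n) →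
  ∃ λ k → IsOrder A-add (A-zero (suc n)) (q g) k × g ^ k ≡ G-one (suc n)
q-order-annihilates n g qg≢0 with ≡-decA (q (g ^ 3)) (A-zero (suc n))
... | yes qg³≡0 = 3 , q-IsOrder g (s≤s z≤n) qg³≡0 below3 , cube≡one n g qg³≡0
  where
  below3 : ∀ m → 0 < m → m < 3 → ¬ q (g ^ m) ≡ A-zero (suc n)
  below3 1 _ _ = qg≢0 ∘ trans (sym (A-identityʳ (q g)))
  below3 2 _ _ = qg≢0 ∘ q-square≡zero⇒q≡zero n g
  below3 (suc (suc (suc _))) _ (s≤s (s≤s (s≤s ())))
... | no qg³≢0 = 9 , q-IsOrder g (s≤s z≤n) (cong q (pow9≡one n g)) below9 , pow9≡one n g
  where
  below9 : ∀ m → 0 < m → m < 9 → ¬ q (g ^ m) ≡ A-zero (suc n)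
  below9 m 0<m m<9 = qg³≢0 ∘ q-pow≡zero⇒q-cube≡zero n g m 0<m m<9

lemma3p2 : (n : ℕ) → n ≥ 1 → (g : G n) → ¬ (q g ≡ A-zero n) →
    ∃ λ k → IsOrder G-mul (G-one n) g k × IsOrder A-add (A-zero n) (q g) k
lemma3p2 (suc n) _ g qg≢0 with q-order-annihilates n g qg≢0
... | k , qg-order , gᵏ≡one = k , IsOrder-lift q (q-pow g) qg-order gᵏ≡one , qg-order
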